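{- Let $t,r\ge1$ be integers and let $\mathcal{P}$ be the set of all partitions. Then, as formal power series in $z,s,q$, $$\sum_{\lambda\in\mathcal{P}} z^{\lambda_1}s^{|\lambda|}q^{\lambda_r+\lambda_{t+r}+\lambda_{2t+r}+\cdots}=\frac{1}{(sz;s)_{r-1}}\prod_{n=0}^\infty\frac{1}{(s^{nt+r}q^{n+1}z;s)_t}.$$
   Context: A partition is a weakly decreasing sequence of nonnegative integers $\lambda=(\lambda_1,\lambda_2,\dots)$, eventually zero, with $\lambda_i=0$ beyond the last nonzero part and $|\lambda|=\sum_i\lambda_i$. The $q$-Pochhammer symbol is $(a;s)_m=\prod_{k=0}^{m-1}(1-as^k)$ for integers $m\ge0$. -}

module Defs where

open import Data.Nat using (ℕ; zero; suc; _+_; _*_; _∸_; _<_; _≥_; _≟_; pred)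
open import Data.Bool using (Bool; true; false; _∧_)
open import Data.List using (List; []; _∷_; length)
open import Data.Nat.ListAction using (sum)
open import Data.List.Relation.Unary.All using (All)
open import Data.List.Relation.Unary.Linked using (Linked)
open import Data.Product using (Σ; _×_; proj₁)
open import Relation.Nullary.Decidable using (⌊_⌋)

-- A partition is represented by the list of its nonzero parts
-- λ₁ ≥ λ₂ ≥ … ≥ λ_ℓ > 0 ; all later parts are 0.
IsPartition : List ℕ → Set
IsPartition l = Linked _≥_ l × All (λ x → 0 < x) l

Partition : Set
Partition = Σ (List ℕ) IsPartition

at : List ℕ → ℕ → ℕ
at []       _       = 0
at (x ∷ _)  zero    = x
at (_ ∷ xs) (suc i) = at xs i

-- λ_i (1-indexed, i ≥ 1); λ_i = 0 beyond the last nonzero part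
part : Partition → ℕ → ℕ
part λ′ i = at (proj₁ λ′) (pred i)

size : Partition → ℕ
size λ′ = sum (proj₁ λ′)

sumTo : ℕ → (ℕ → ℕ) → ℕ
sumTo zero    f = f 0
sumTo (suc n) f = sumTo n f + f (suc n)

-- λ_r + λ_{t+r} + λ_{2t+r} + ⋯ ; the terms with m > ℓ(λ) vanish since
-- m t + r > ℓ(λ) then (t, r ≥ 1), so summing over m = 0 … ℓ(λ) is the full sum.
stat : ℕ → ℕ → Partition → ℕ
stat t r λ′ = sumTo (length (proj₁ λ′)) (λ m → part λ′ (m * t + r))

-- Formal power series in z, s, q with ℕ coefficients
-- (all series involved have nonnegative integer coefficients).
-- f a b c = coefficient of z^a s^b q^c.

Series : Set
Series = ℕ → ℕ → ℕ → ℕ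

one : Series
one zero zero zero = 1
one _    _    _    = 0

_⊛_ : Series → Series → Series
(f ⊛ g) a b c =
  sumTo a (λ i → sumTo b (λ j → sumTo c (λ k →
    f i j k * g (a ∸ i) (b ∸ j) (c ∸ k))))

infixl 7 _⊛_

χ : Bool → ℕ
χ true  = 1
χ false = 0

-- geom α β γ = 1 / (1 - z^α s^β q^γ) = Σ_{j ≥ 0} z^{jα} s^{jβ} q^{jγ},
-- intended for (α,β,γ) ≠ (0,0,0): then only j ≤ a+b+c can contribute
-- to the coefficient of z^a s^b q^c, and at most one j does.
geom : ℕ → ℕ → ℕ → Series
geom α β γ a b c =
  sumTo (a + b + c) (λ j →
    χ (⌊ a ≟ j * α ⌋ ∧ ⌊ b ≟ j * β ⌋ ∧ ⌊ c ≟ j * γ ⌋))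

prodTo : ℕ → (ℕ → Series) → Series
prodTo zero    F = one
prodTo (suc m) F = prodTo m F ⊛ F m

-- 1 / (x ; s)_m  for the monomial x = z^α s^β q^γ :
-- 1/(x;s)_m = Π_{k<m} 1/(1 - z^α s^{β+k} q^γ)
invPoch : ℕ → ℕ → ℕ → ℕ → Series
invPoch α β γ m = prodTo m (λ k → geom α (β + k) γ)

-- N-th partial product of the right-hand side:
-- 1/(sz;s)_{r-1} · Π_{n<N} 1/(s^{nt+r} q^{n+1} z ; s)_t
rhsPartial : ℕ → ℕ → ℕ → Series
rhsPartial t r N =
  invPoch 1 1 0 (r ∸ 1) ⊛ prodTo N (λ n → invPoch 1 (n * t + r) (suc n) t)

{-# OPTIONS --safe #-}
module Submission where

-- Read the N-th partial product of the right-hand side as a product of geometric series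
-- 1/(1 - z s^h q^g(h)), one for each h = 1, …, M = r - 1 + N t, where g(h) counts the rows
-- r, t + r, 2t + r, … that are at most h: the factors of 1/(s^(nt+r) q^(n+1) z; s)_t are exactly
-- those with nt + r ≤ h < (n+1)t + r.  A monomial of this product is a choice of multiplicities
-- mₕ, i.e. the Young diagram with mₕ columns of height h.  That diagram has λ₁ = Σ mₕ,
-- |λ| = Σ h mₕ, and its columns meet the rows r, t + r, … in Σ g(h) mₕ = λ_r + λ_(t+r) + ⋯ cells.
-- A partition of b has no column taller than b, so once M ≥ b every partition of b occurs.

open import Defs
open import Data.Empty using (⊥-elim)
open import Data.Fin using (Fin; zero)
open import Data.Fin.Properties using (+↔⊎; *↔×)
open import Data.List using (List; []; _∷_; _++_; length; map; take; drop)
open import Data.List.Properties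
  using (length-++; length-map; length-take; length-drop; map-++; map-∘; map-id; take++drop≡id)
import Data.List.Relation.Unary.All as All
open import Data.List.Relation.Unary.All using (All; []; _∷_)
import Data.List.Relation.Unary.Linked as Linked
open import Data.List.Relation.Unary.Linked using (Linked; []; [-]; _∷_)
open import Data.Bool using (true; false; _∧_)
open import Data.Nat using (ℕ; zero; suc; pred; _+_; _*_; _∸_; _≤_; _≥_; _<_; z≤n; s≤s; s≤s⁻¹; _≟_)
open import Data.Nat.Properties
open import Data.Nat.ListAction using (sum)
open import Data.Nat.ListAction.Properties using (sum-++)
open import Data.Nat.Tactic.RingSolver using (solve-∀)
open import Data.Product using (Σ; Σ-syntax; ∃; _×_; _,_; proj₁; proj₂)
open import Data.Product.Function.Dependent.Propositional using (congˡ)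
open import Data.Product.Function.NonDependent.Propositional using (_×-↔_)
open import Data.Sum using (_⊎_; inj₁; inj₂)
open import Data.Sum.Function.Propositional using (_⊎-↔_)
open import Function using (_∘_)
open import Function.Bundles using (_↔_; mk↔ₛ′; Inverse)
open import Function.Properties.Inverse using (↔-refl; ↔-trans)
open import Function.Related.Propositional using (module EquationalReasoning; Kind)
open import Relation.Binary.PropositionalEquality
  using (_≡_; refl; sym; trans; cong; cong₂; subst; module ≡-Reasoning)
open import Relation.Nullary using (¬_; Dec; yes; no)
open import Relation.Nullary.Decidable using (⌊_⌋)
import Relation.Nullary.Irrelevant as Nullary
open import Relation.Unary using (Irrelevant)

module ↔-Reasoning = EquationalReasoning {k = Kind.bijection}

×-irrelevant : {A B : Set} → Nullary.Irrelevant A → Nullary.Irrelevant B → Nullary.Irrelevant (A × B)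
×-irrelevant irrA irrB (a , b) (a′ , b′) = cong₂ _,_ (irrA a a′) (irrB b b′)

≡³-irrelevant : ∀ {a b c a′ b′ c′ : ℕ} → Nullary.Irrelevant (a ≡ a′ × b ≡ b′ × c ≡ c′)
≡³-irrelevant = ×-irrelevant ≡-irrelevant (×-irrelevant ≡-irrelevant ≡-irrelevant)

proj₁-injective : {A : Set} {P : A → Set} → Irrelevant P →
  {u v : Σ A P} → proj₁ u ≡ proj₁ v → u ≡ v
proj₁-injective irr {x , p} {.x , q} refl = cong (x ,_) (irr p q)

-- Coefficients as cardinalities

Σ≤ : ℕ → (ℕ → Set) → Set
Σ≤ n P = Σ[ i ∈ ℕ ] (i ≤ n × P i)

Σ≤-cong : ∀ {n} {P Q : ℕ → Set} → (∀ {i} → P i ↔ Q i) → Σ≤ n P ↔ Σ≤ n Q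
Σ≤-cong P↔Q = congˡ (↔-refl ×-↔ P↔Q)

Σ≤-suc : ∀ n (P : ℕ → Set) → (Σ≤ n P ⊎ P (suc n)) ↔ Σ≤ (suc n) P
Σ≤-suc n P = mk↔ₛ′ extend split extend∘split split∘extend
  where
  extend : Σ≤ n P ⊎ P (suc n) → Σ≤ (suc n) P
  extend (inj₁ (i , i≤n , x)) = i , m≤n⇒m≤1+n i≤n , x
  extend (inj₂ x)             = suc n , ≤-refl , x

  split : Σ≤ (suc n) P → Σ≤ n P ⊎ P (suc n)
  split (i , i≤1+n , x) with m≤n⇒m<n∨m≡n i≤1+n
  ... | inj₁ i<1+n = inj₁ (i , s≤s⁻¹ i<1+n , x)
  ... | inj₂ refl  = inj₂ x

  extend∘split : ∀ y → extend (split y) ≡ y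
  extend∘split (i , i≤1+n , x) with m≤n⇒m<n∨m≡n i≤1+n
  ... | inj₁ _    = cong (λ p → i , p , x) (≤-irrelevant _ _)
  ... | inj₂ refl = cong (λ p → suc n , p , x) (≤-irrelevant _ _)

  split∘extend : ∀ y → split (extend y) ≡ y
  split∘extend (inj₁ (i , i≤n , x)) with m≤n⇒m<n∨m≡n (m≤n⇒m≤1+n i≤n)
  ... | inj₁ _    = cong (λ p → inj₁ (i , p , x)) (≤-irrelevant _ _)
  ... | inj₂ refl = ⊥-elim (1+n≰n i≤n)
  split∘extend (inj₂ x) with m≤n⇒m<n∨m≡n (≤-refl {suc n})
  ... | inj₁ 1+n<1+n = ⊥-elim (<-irrefl refl 1+n<1+n)
  ... | inj₂ refl      = refl

Fin-sumTo : ∀ n (f : ℕ → ℕ) → Fin (sumTo n f) ↔ Σ≤ n (Fin ∘ f)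
Fin-sumTo zero f =
  mk↔ₛ′ (λ x → 0 , z≤n , x) (λ { (_ , z≤n , x) → x }) (λ { (_ , z≤n , x) → refl }) (λ _ → refl)
Fin-sumTo (suc n) f = begin
  Fin (sumTo n f + f (suc n))          ↔⟨ +↔⊎ ⟩
  (Fin (sumTo n f) ⊎ Fin (f (suc n)))  ↔⟨ Fin-sumTo n f ⊎-↔ ↔-refl ⟩
  (Σ≤ n (Fin ∘ f) ⊎ Fin (f (suc n)))   ↔⟨ Σ≤-suc n (Fin ∘ f) ⟩
  Σ≤ (suc n) (Fin ∘ f)                 ∎
  where open ↔-Reasoning

Fin-⊛ : ∀ (f g : Series) a b c → Fin ((f ⊛ g) a b c) ↔
  (Σ≤ a λ i → Σ≤ b λ j → Σ≤ c λ k → Fin (f i j k) × Fin (g (a ∸ i) (b ∸ j) (c ∸ k)))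
Fin-⊛ f g a b c =
  ↔-trans (Fin-sumTo a _) (Σ≤-cong (
  ↔-trans (Fin-sumTo b _) (Σ≤-cong (
  ↔-trans (Fin-sumTo c _) (Σ≤-cong *↔×)))))

Fin0↔ : {A : Set} → ¬ A → Fin 0 ↔ A
Fin0↔ ¬a = mk↔ₛ′ (λ ()) (⊥-elim ∘ ¬a) (⊥-elim ∘ ¬a) (λ ())

Fin-χ : {P : Set} (d : Dec P) → Nullary.Irrelevant P → Fin (χ ⌊ d ⌋) ↔ P
Fin-χ (yes p) irr = mk↔ₛ′ (λ _ → p) (λ _ → zero) (irr p) (λ { zero → refl })
Fin-χ (no ¬p) _   = Fin0↔ ¬p

χ-∧ : ∀ x y → χ (x ∧ y) ≡ χ x * χ y
χ-∧ true  y = sym (+-identityʳ (χ y))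
χ-∧ false y = refl

Fin-χ-∧ : ∀ x y → Fin (χ (x ∧ y)) ↔ (Fin (χ x) × Fin (χ y))
Fin-χ-∧ x y = subst (λ n → Fin n ↔ (Fin (χ x) × Fin (χ y))) (sym (χ-∧ x y)) (*↔× {χ x})

-- Types graded by the exponents of z, s and q

record Graded : Set₁ where
  field
    Carrier        : Set
    zdeg sdeg qdeg : Carrier → ℕ
open Graded

Fibre : Graded → ℕ → ℕ → ℕ → Set
Fibre A a b c = Σ[ x ∈ Carrier A ] (zdeg A x ≡ a × sdeg A x ≡ b × qdeg A x ≡ c)

fibre-≡ : ∀ {A a b c} {x y : Fibre A a b c} → proj₁ x ≡ proj₁ y → x ≡ y
fibre-≡ = proj₁-injective ≡³-irrelevant

record _≅_ (A B : Graded) : Set where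
  field
    carrier↔ : Carrier A ↔ Carrier B
  open Inverse carrier↔ public using (to; from; strictlyInverseˡ; strictlyInverseʳ)
  field
    zdeg-to : ∀ x → zdeg B (to x) ≡ zdeg A x
    sdeg-to : ∀ x → sdeg B (to x) ≡ sdeg A x
    qdeg-to : ∀ x → qdeg B (to x) ≡ qdeg A x

fibre-≅ : ∀ {A B} → A ≅ B → ∀ a b c → Fibre A a b c ↔ Fibre B a b c
fibre-≅ {A} {B} A≅B a b c =
  mk↔ₛ′ to′ from′ (λ _ → fibre-≡ (strictlyInverseˡ _)) (λ _ → fibre-≡ (strictlyInverseʳ _))
  where
  open _≅_ A≅B
  to′ : Fibre A a b c → Fibre B a b c
  to′ (x , e₁ , e₂ , e₃) = to x , trans (zdeg-to x) e₁ , trans (sdeg-to x) e₂ , trans (qdeg-to x) e₃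
  from′ : Fibre B a b c → Fibre A a b c
  from′ (y , e₁ , e₂ , e₃) = from y , deg-from (zdeg A) (zdeg B) zdeg-to e₁
    , deg-from (sdeg A) (sdeg B) sdeg-to e₂ , deg-from (qdeg A) (qdeg B) qdeg-to e₃
    where
    deg-from : ∀ (dA : Carrier A → ℕ) (dB : Carrier B → ℕ) {n} →
      (∀ x → dB (to x) ≡ dA x) → dB y ≡ n → dA (from y) ≡ n
    deg-from dA dB d-to e = trans (sym (d-to (from y))) (trans (cong dB (strictlyInverseˡ y)) e)

_⊗_ : Graded → Graded → Graded
A ⊗ B = record
  { Carrier = Carrier A × Carrier B
  ; zdeg    = λ (x , y) → zdeg A x + zdeg B y
  ; sdeg    = λ (x , y) → sdeg A x + sdeg B y
  ; qdeg    = λ (x , y) → qdeg A x + qdeg B y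
  }

fibre-⊗ : ∀ A B a b c →
  (Σ≤ a λ i → Σ≤ b λ j → Σ≤ c λ k → Fibre A i j k × Fibre B (a ∸ i) (b ∸ j) (c ∸ k))
  ↔ Fibre (A ⊗ B) a b c
fibre-⊗ A B a b c = mk↔ₛ′ to from (λ _ → fibre-≡ refl) from∘to
  where
  Splittings : Set
  Splittings = Σ≤ a λ i → Σ≤ b λ j → Σ≤ c λ k → Fibre A i j k × Fibre B (a ∸ i) (b ∸ j) (c ∸ k)

  join : ∀ {i d n} → i ≤ n → d ≡ n ∸ i → i + d ≡ n
  join i≤n refl = m+[n∸m]≡n i≤n

  bound : ∀ {i d n} → i + d ≡ n → i ≤ n
  bound refl = m≤m+n _ _

  rest : ∀ {i d n} → i + d ≡ n → d ≡ n ∸ i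
  rest {i} {d} refl = sym (m+n∸m≡n i d)

  to : Splittings → Fibre (A ⊗ B) a b c
  to (_ , i≤a , _ , j≤b , _ , k≤c , (x , refl , refl , refl) , (y , e₁ , e₂ , e₃)) =
    (x , y) , join i≤a e₁ , join j≤b e₂ , join k≤c e₃

  from : Fibre (A ⊗ B) a b c → Splittings
  from ((x , y) , e₁ , e₂ , e₃) =
    zdeg A x , bound e₁ , sdeg A x , bound e₂ , qdeg A x , bound e₃ ,
    (x , refl , refl , refl) , (y , rest e₁ , rest e₂ , rest e₃)

  from∘to : ∀ s → from (to s) ≡ s
  from∘to (_ , i≤a , _ , j≤b , _ , k≤c , (x , refl , refl , refl) , (y , e)) =
    cong₂ (λ (p , q , r) e → _ , p , _ , q , _ , r , (x , refl , refl , refl) , (y , e))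
      (×-irrelevant ≤-irrelevant (×-irrelevant ≤-irrelevant ≤-irrelevant) _ _)
      (≡³-irrelevant _ _)

Weight : Set
Weight = ℕ × ℕ

infixl 7 _·_

_·_ : List ℕ → List ℕ → ℕ
(m ∷ ms) · (w ∷ ws) = m * w + ms · ws
_        · _        = 0

·-++ : ∀ xs ys vs ws → length xs ≡ length vs → (xs ++ ys) · (vs ++ ws) ≡ xs · vs + ys · ws
·-++ []       ys []       ws _ = refl
·-++ (x ∷ xs) ys (v ∷ vs) ws e =
  trans (cong (x * v +_) (·-++ xs ys vs ws (suc-injective e))) (sym (+-assoc (x * v) _ _))

-- A multiplicity m for the factor 1/(1 - z s^β q^γ), (β , γ) ∈ W, contributes z^m s^(m β) q^(m γ).
Multiplicities : List Weight → Graded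
Multiplicities W = record
  { Carrier = Σ[ ms ∈ List ℕ ] length ms ≡ length W
  ; zdeg    = λ (ms , _) → sum ms
  ; sdeg    = λ (ms , _) → ms · map proj₁ W
  ; qdeg    = λ (ms , _) → ms · map proj₂ W
  }

multiplicities-≡ : ∀ {W} {u v : Carrier (Multiplicities W)} → proj₁ u ≡ proj₁ v → u ≡ v
multiplicities-≡ = proj₁-injective ≡-irrelevant

take-++ : ∀ {A : Set} {n} (xs ys : List A) → length xs ≡ n → take n (xs ++ ys) ≡ xs
take-++ []       ys refl = refl
take-++ (x ∷ xs) ys refl = cong (x ∷_) (take-++ xs ys refl)

drop-++ : ∀ {A : Set} {n} (xs ys : List A) → length xs ≡ n → drop n (xs ++ ys) ≡ ys
drop-++ []       ys refl = refl
drop-++ (x ∷ xs) ys refl = drop-++ xs ys refl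

Multiplicities-++ : ∀ V W → (Multiplicities V ⊗ Multiplicities W) ≅ Multiplicities (V ++ W)
Multiplicities-++ V W = record
  { carrier↔ = mk↔ₛ′ append split append∘split split∘append
  ; zdeg-to  = λ ((xs , _) , (ys , _)) → sum-++ xs ys
  ; sdeg-to  = λ ((xs , p) , (ys , _)) → ·-map-++ proj₁ xs ys p
  ; qdeg-to  = λ ((xs , p) , (ys , _)) → ·-map-++ proj₂ xs ys p
  }
  where
  append : Carrier (Multiplicities V ⊗ Multiplicities W) → Carrier (Multiplicities (V ++ W))
  append ((xs , p) , (ys , q)) = xs ++ ys , trans (length-++ xs) (trans (cong₂ _+_ p q) (sym (length-++ V)))

  split : Carrier (Multiplicities (V ++ W)) → Carrier (Multiplicities V ⊗ Multiplicities W)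
  split (zs , r) = (take (length V) zs , length-take-V) , (drop (length V) zs , length-drop-V)
    where
    r′ : length zs ≡ length V + length W
    r′ = trans r (length-++ V)
    length-take-V : length (take (length V) zs) ≡ length V
    length-take-V = trans (length-take (length V) zs)
      (m≤n⇒m⊓n≡m (subst (length V ≤_) (sym r′) (m≤m+n (length V) (length W))))
    length-drop-V : length (drop (length V) zs) ≡ length W
    length-drop-V = trans (length-drop (length V) zs)
      (trans (cong (_∸ length V) r′) (m+n∸m≡n (length V) (length W)))

  append∘split : ∀ z → append (split z) ≡ z
  append∘split (zs , _) = multiplicities-≡ {V ++ W} (take++drop≡id (length V) zs)

  split∘append : ∀ x → split (append x) ≡ x
  split∘append ((xs , p) , (ys , _)) =
    cong₂ _,_ (multiplicities-≡ {V} (take-++ xs ys p)) (multiplicities-≡ {W} (drop-++ xs ys p))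

  ·-map-++ : ∀ (f : Weight → ℕ) xs ys → length xs ≡ length V →
    (xs ++ ys) · map f (V ++ W) ≡ xs · map f V + ys · map f W
  ·-map-++ f xs ys p =
    trans (cong ((xs ++ ys) ·_) (map-++ f V W)) (·-++ xs ys _ _ (trans p (sym (length-map f V))))

range : ℕ → ℕ → List ℕ
range k zero    = []
range k (suc n) = k ∷ range (suc k) n

range-+ : ∀ k m n → range k (m + n) ≡ range k m ++ range (k + m) n
range-+ k zero    n = cong (λ k′ → range k′ n) (sym (+-identityʳ k))
range-+ k (suc m) n =
  cong (k ∷_) (trans (range-+ (suc k) m n) (cong (λ k′ → range (suc k) m ++ range k′ n) (sym (+-suc k m))))

map-cong-range : ∀ {A : Set} {f g : ℕ → A} β n → (∀ k → k < n → f (β + k) ≡ g (β + k)) →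
  map f (range β n) ≡ map g (range β n)
map-cong-range β zero    _  = refl
map-cong-range {f = f} {g} β (suc n) eq =
  cong₂ _∷_ (shift (+-identityʳ β) (eq 0 (s≤s z≤n)))
            (map-cong-range (suc β) n (λ k k<n → shift (+-suc β k) (eq (suc k) (s≤s k<n))))
  where
  shift : ∀ {h h′} → h ≡ h′ → f h ≡ g h → f h′ ≡ g h′
  shift refl e = e

concatUpTo : ∀ {A : Set} → ℕ → (ℕ → List A) → List A
concatUpTo zero    Ws = []
concatUpTo (suc m) Ws = concatUpTo m Ws ++ Ws m

concatUpTo-cong : ∀ {A : Set} m {Ws Vs : ℕ → List A} →
  (∀ k → Ws k ≡ Vs k) → concatUpTo m Ws ≡ concatUpTo m Vs
concatUpTo-cong zero    _  = refl
concatUpTo-cong (suc m) eq = cong₂ _++_ (concatUpTo-cong m eq) (eq m)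

concatUpTo-singletons : ∀ {A : Set} (f : ℕ → A) β m →
  concatUpTo m (λ k → f (β + k) ∷ []) ≡ map f (range β m)
concatUpTo-singletons f β zero    = refl
concatUpTo-singletons f β (suc m) = begin
  concatUpTo m (λ k → f (β + k) ∷ []) ++ f (β + m) ∷ []  ≡⟨ cong (_++ _) (concatUpTo-singletons f β m) ⟩
  map f (range β m) ++ map f (range (β + m) 1)           ≡⟨ map-++ f (range β m) _ ⟨
  map f (range β m ++ range (β + m) 1)                   ≡⟨ cong (map f) (range-+ β m 1) ⟨
  map f (range β (m + 1))                                ≡⟨ cong (map f ∘ range β) (+-comm m 1) ⟩
  map f (range β (suc m))                                ∎
  where open ≡-Reasoning

concatUpTo-blocks : ∀ {A : Set} (f : ℕ → A) ℓ β N →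
  concatUpTo N (λ n → map f (range (n * ℓ + β) ℓ)) ≡ map f (range β (N * ℓ))
concatUpTo-blocks f ℓ β zero    = refl
concatUpTo-blocks f ℓ β (suc N) = begin
  concatUpTo N (λ n → map f (range (n * ℓ + β) ℓ)) ++ map f (range (N * ℓ + β) ℓ)
    ≡⟨ cong₂ _++_ (concatUpTo-blocks f ℓ β N) (cong (λ k → map f (range k ℓ)) (+-comm (N * ℓ) β)) ⟩
  map f (range β (N * ℓ)) ++ map f (range (β + N * ℓ) ℓ)
    ≡⟨ map-++ f (range β (N * ℓ)) _ ⟨
  map f (range β (N * ℓ) ++ range (β + N * ℓ) ℓ)
    ≡⟨ cong (map f) (range-+ β (N * ℓ) ℓ) ⟨
  map f (range β (N * ℓ + ℓ))
    ≡⟨ cong (map f ∘ range β) (+-comm (N * ℓ) ℓ) ⟩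
  map f (range β (suc N * ℓ))
    ∎
  where open ≡-Reasoning

-- Products of geometric series

Counts : Series → List Weight → Set
Counts F W = ∀ a b c → Fin (F a b c) ↔ Fibre (Multiplicities W) a b c

one-counts : Counts one []
one-counts zero    zero    zero    = mk↔ₛ′ (λ _ → ([] , refl) , refl , refl , refl) (λ _ → zero)
  (λ { (([] , refl) , refl , refl , refl) → refl }) (λ { zero → refl })
one-counts (suc a) b       c       = Fin0↔ λ { (([] , _) , () , _) }
one-counts zero    (suc b) c       = Fin0↔ λ { (([] , _) , _ , () , _) }
one-counts zero    zero    (suc c) = Fin0↔ λ { (([] , _) , _ , _ , ()) }

Fin-geom : ∀ α β γ a b c →
  Fin (geom α β γ a b c) ↔ Σ≤ (a + b + c) (λ j → a ≡ j * α × b ≡ j * β × c ≡ j * γ)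
Fin-geom α β γ a b c = ↔-trans (Fin-sumTo (a + b + c) _) (Σ≤-cong (λ {j} →
  ↔-trans (Fin-χ-∧ _ _) (Fin-χ (a ≟ j * α) ≡-irrelevant ×-↔
  ↔-trans (Fin-χ-∧ _ _) (Fin-χ (b ≟ j * β) ≡-irrelevant ×-↔ Fin-χ (c ≟ j * γ) ≡-irrelevant))))

geom-counts : ∀ β γ → Counts (geom 1 β γ) ((β , γ) ∷ [])
geom-counts β γ a b c = ↔-trans (Fin-geom 1 β γ a b c) (mk↔ₛ′ to from to∘from from∘to)
  where
  Powers : Set
  Powers = Σ≤ (a + b + c) (λ j → a ≡ j * 1 × b ≡ j * β × c ≡ j * γ)

  to : Powers → Fibre (Multiplicities ((β , γ) ∷ [])) a b c
  to (j , _ , e₁ , e₂ , e₃) = (j ∷ [] , refl) ,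
    trans (+-identityʳ j) (trans (sym (*-identityʳ j)) (sym e₁)) ,
    trans (+-identityʳ _) (sym e₂) ,
    trans (+-identityʳ _) (sym e₃)

  from : Fibre (Multiplicities ((β , γ) ∷ [])) a b c → Powers
  from ((m ∷ [] , _) , d₁ , d₂ , d₃) =
    m , ≤-trans (≤-reflexive m≡a) (≤-trans (m≤m+n a b) (m≤m+n (a + b) c)) ,
    trans (sym m≡a) (sym (*-identityʳ m)) , trans (sym d₂) (+-identityʳ _) , trans (sym d₃) (+-identityʳ _)
    where
    m≡a : m ≡ a
    m≡a = trans (sym (+-identityʳ m)) d₁

  to∘from : ∀ x → to (from x) ≡ x
  to∘from ((_ ∷ [] , _) , _) = fibre-≡ (multiplicities-≡ {(β , γ) ∷ []} refl)

  from∘to : ∀ p → from (to p) ≡ p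
  from∘to _ = proj₁-injective (×-irrelevant ≤-irrelevant ≡³-irrelevant) refl

⊛-counts : ∀ {F G V W} → Counts F V → Counts G W → Counts (F ⊛ G) (V ++ W)
⊛-counts {F} {G} {V} {W} F-V G-W a b c = begin
  Fin ((F ⊛ G) a b c)
    ↔⟨ Fin-⊛ F G a b c ⟩
  (Σ≤ a λ i → Σ≤ b λ j → Σ≤ c λ k → Fin (F i j k) × Fin (G (a ∸ i) (b ∸ j) (c ∸ k)))
    ↔⟨ Σ≤-cong (λ {i} → Σ≤-cong (λ {j} → Σ≤-cong (λ {k} → F-V i j k ×-↔ G-W (a ∸ i) (b ∸ j) (c ∸ k)))) ⟩
  (Σ≤ a λ i → Σ≤ b λ j → Σ≤ c λ k →
     Fibre (Multiplicities V) i j k × Fibre (Multiplicities W) (a ∸ i) (b ∸ j) (c ∸ k))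
    ↔⟨ fibre-⊗ (Multiplicities V) (Multiplicities W) a b c ⟩
  Fibre (Multiplicities V ⊗ Multiplicities W) a b c
    ↔⟨ fibre-≅ (Multiplicities-++ V W) a b c ⟩
  Fibre (Multiplicities (V ++ W)) a b c
    ∎
  where open ↔-Reasoning

prodTo-counts : ∀ m {F Ws} → (∀ k → Counts (F k) (Ws k)) → Counts (prodTo m F) (concatUpTo m Ws)
prodTo-counts zero    _    = one-counts
prodTo-counts (suc m) F-Ws = ⊛-counts (prodTo-counts m F-Ws) (F-Ws m)

invPoch-counts : ∀ β γ m → Counts (invPoch 1 β γ m) (map (_, γ) (range β m))
invPoch-counts β γ m =
  subst (Counts _) (concatUpTo-singletons (_, γ) β m) (prodTo-counts m (λ k → geom-counts (β + k) γ))

-- Rows r′ + 1, r′ + 1 + (t′ + 1), r′ + 1 + 2 (t′ + 1), … are marked; the second argument counts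
-- down the rows left before the next marked one.
markedRows : ℕ → ℕ → ℕ → ℕ
markedRows t′ r′       zero    = 0
markedRows t′ (suc r′) (suc h) = markedRows t′ r′ h
markedRows t′ zero     (suc h) = suc (markedRows t′ t′ h)

markedSum : ℕ → ℕ → List ℕ → ℕ
markedSum t′ r′       []       = 0
markedSum t′ (suc r′) (x ∷ xs) = markedSum t′ r′ xs
markedSum t′ zero     (x ∷ xs) = x + markedSum t′ t′ xs

markedRows-before : ∀ t′ r′ h → h ≤ r′ → markedRows t′ r′ h ≡ 0
markedRows-before t′ r′       zero    _         = refl
markedRows-before t′ (suc r′) (suc h) (s≤s h≤r′) = markedRows-before t′ r′ h h≤r′

markedRows-past-first : ∀ t′ r′ h → markedRows t′ r′ (r′ + suc h) ≡ suc (markedRows t′ t′ h)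
markedRows-past-first t′ zero     h = refl
markedRows-past-first t′ (suc r′) h = markedRows-past-first t′ r′ h

markedRows-period : ∀ t′ n k → k ≤ t′ → markedRows t′ t′ (n * suc t′ + k) ≡ n
markedRows-period t′ zero    k k≤t′ = markedRows-before t′ t′ k k≤t′
markedRows-period t′ (suc n) k k≤t′ = begin
  markedRows t′ t′ (suc n * suc t′ + k)        ≡⟨ cong (markedRows t′ t′) (+-suc-shift t′ (n * suc t′) k) ⟩
  markedRows t′ t′ (t′ + suc (n * suc t′ + k)) ≡⟨ markedRows-past-first t′ t′ _ ⟩
  suc (markedRows t′ t′ (n * suc t′ + k))      ≡⟨ cong suc (markedRows-period t′ n k k≤t′) ⟩
  suc n                                        ∎
  where
  open ≡-Reasoning
  +-suc-shift : ∀ t m k → suc t + m + k ≡ t + suc (m + k)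
  +-suc-shift = solve-∀

markedRows-block : ∀ t′ r′ n k → k < suc t′ → markedRows t′ r′ (n * suc t′ + suc r′ + k) ≡ suc n
markedRows-block t′ r′ n k (s≤s k≤t′) = begin
  markedRows t′ r′ (n * suc t′ + suc r′ + k)   ≡⟨ cong (markedRows t′ r′) (shift r′ (n * suc t′) k) ⟩
  markedRows t′ r′ (r′ + suc (n * suc t′ + k)) ≡⟨ markedRows-past-first t′ r′ _ ⟩
  suc (markedRows t′ t′ (n * suc t′ + k))      ≡⟨ cong suc (markedRows-period t′ n k k≤t′) ⟩
  suc n                                        ∎
  where
  open ≡-Reasoning
  shift : ∀ r m k → m + suc r + k ≡ r + suc (m + k)
  shift = solve-∀

columnWeights : ℕ → ℕ → ℕ → List Weight
columnWeights t′ r′ M = map (λ h → h , markedRows t′ r′ h) (range 1 M)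

rhsWeights : ℕ → ℕ → ℕ → List Weight
rhsWeights t′ r′ N =
  map (_, 0) (range 1 r′) ++ concatUpTo N (λ n → map (_, suc n) (range (n * suc t′ + suc r′) (suc t′)))

rhsWeights≡columnWeights : ∀ t′ r′ N → rhsWeights t′ r′ N ≡ columnWeights t′ r′ (r′ + N * suc t′)
rhsWeights≡columnWeights t′ r′ N = begin
  rhsWeights t′ r′ N
    ≡⟨ cong₂ _++_
         (map-cong-range 1 r′ λ k k<r′ → cong (suc k ,_) (sym (markedRows-before t′ r′ (suc k) k<r′)))
         (concatUpTo-cong N λ n → map-cong-range _ (suc t′) λ k k<t →
            cong (n * suc t′ + suc r′ + k ,_) (sym (markedRows-block t′ r′ n k k<t))) ⟩
  map weight (range 1 r′) ++ concatUpTo N (λ n → map weight (range (n * suc t′ + suc r′) (suc t′)))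
    ≡⟨ cong (map weight (range 1 r′) ++_) (concatUpTo-blocks weight (suc t′) (suc r′) N) ⟩
  map weight (range 1 r′) ++ map weight (range (suc r′) (N * suc t′))
    ≡⟨ map-++ weight (range 1 r′) _ ⟨
  map weight (range 1 r′ ++ range (1 + r′) (N * suc t′))
    ≡⟨ cong (map weight) (range-+ 1 r′ (N * suc t′)) ⟨
  columnWeights t′ r′ (r′ + N * suc t′)
    ∎
  where
  open ≡-Reasoning
  weight : ℕ → Weight
  weight h = h , markedRows t′ r′ h

rhsPartial-counts : ∀ t′ r′ N →
  Counts (rhsPartial (suc t′) (suc r′) N) (columnWeights t′ r′ (r′ + N * suc t′))
rhsPartial-counts t′ r′ N = subst (Counts _) (rhsWeights≡columnWeights t′ r′ N)
  (⊛-counts (invPoch-counts 1 0 r′)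
            (prodTo-counts N (λ n → invPoch-counts (n * suc t′ + suc r′) (suc n) (suc t′))))

-- Partitions from column counts

-- Drops l when x is 0; every use has l ≡ [] in that case.
cons⁺ : ℕ → List ℕ → List ℕ
cons⁺ zero    _ = []
cons⁺ (suc x) l = suc x ∷ l

cons⁺-invariant : ∀ {B : Set} (f : List ℕ → B) → f [] ≡ f (0 ∷ []) →
  ∀ {x l} → (x ≡ 0 → l ≡ []) → f (cons⁺ x l) ≡ f (x ∷ l)
cons⁺-invariant f f[0] {zero}  l≡[] rewrite l≡[] refl = f[0]
cons⁺-invariant f f[0] {suc x} _    = refl

at-cons⁺ : ∀ x l → at (cons⁺ x l) 0 ≡ x
at-cons⁺ zero    l = refl
at-cons⁺ (suc x) l = refl

cons⁺-positive : ∀ {x l} → 0 < x → cons⁺ x l ≡ x ∷ l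
cons⁺-positive {suc x} _ = refl

cons⁺-isPartition : ∀ x l → IsPartition l → at l 0 ≤ x → IsPartition (cons⁺ x l)
cons⁺-isPartition zero    l        _         _   = [] , []
cons⁺-isPartition (suc x) []       _         _   = [-] , (s≤s z≤n ∷ [])
cons⁺-isPartition (suc x) (y ∷ ys) (lk , al) y≤x = (y≤x ∷ lk) , (s≤s z≤n ∷ al)

length-cons⁺ : ∀ x l → length (cons⁺ x l) ≤ suc (length l)
length-cons⁺ zero    l = z≤n
length-cons⁺ (suc x) l = ≤-refl

-- fromColumns (m₁ ∷ m₂ ∷ …) is the partition with mₕ columns of height h;
-- its j-th part is mⱼ + mⱼ₊₁ + ⋯.
fromColumns : List ℕ → List ℕ
fromColumns []       = []
fromColumns (m ∷ ms) = cons⁺ (m + at (fromColumns ms) 0) (fromColumns ms)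

columnCounts : ℕ → List ℕ → List ℕ
columnCounts zero    _        = []
columnCounts (suc M) []       = 0 ∷ columnCounts M []
columnCounts (suc M) (x ∷ xs) = (x ∸ at xs 0) ∷ columnCounts M xs

at-fromColumns : ∀ ms → at (fromColumns ms) 0 ≡ sum ms
at-fromColumns []       = refl
at-fromColumns (m ∷ ms) = trans (at-cons⁺ _ (fromColumns ms)) (cong (m +_) (at-fromColumns ms))

fromColumns-null : ∀ m ms → m + at (fromColumns ms) 0 ≡ 0 → fromColumns ms ≡ []
fromColumns-null m ms e = null ms (m+n≡0⇒n≡0 m e)
  where
  null : ∀ ms → at (fromColumns ms) 0 ≡ 0 → fromColumns ms ≡ []
  null []       _ = refl
  null (m ∷ ms) e with m + at (fromColumns ms) 0
  ... | zero = refl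

fromColumns-isPartition : ∀ ms → IsPartition (fromColumns ms)
fromColumns-isPartition []       = [] , []
fromColumns-isPartition (m ∷ ms) =
  cons⁺-isPartition _ (fromColumns ms) (fromColumns-isPartition ms) (m≤n+m _ m)

length-fromColumns : ∀ ms → length (fromColumns ms) ≤ length ms
length-fromColumns []       = z≤n
length-fromColumns (m ∷ ms) =
  ≤-trans (length-cons⁺ (m + at (fromColumns ms) 0) (fromColumns ms)) (s≤s (length-fromColumns ms))

length-columnCounts : ∀ M l → length (columnCounts M l) ≡ M
length-columnCounts zero    _        = refl
length-columnCounts (suc M) []       = cong suc (length-columnCounts M [])
length-columnCounts (suc M) (x ∷ xs) = cong suc (length-columnCounts M xs)

fromColumns-columnCounts : ∀ M l → IsPartition l → length l ≤ M → fromColumns (columnCounts M l) ≡ l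
fromColumns-columnCounts zero    []       _  _ = refl
fromColumns-columnCounts (suc M) []       _  _ =
  cong (λ l → cons⁺ (at l 0) l) (fromColumns-columnCounts M [] ([] , []) z≤n)
fromColumns-columnCounts (suc M) (x ∷ xs) ip (s≤s len) = begin
  cons⁺ (x ∸ at xs 0 + at (fromColumns (columnCounts M xs)) 0) (fromColumns (columnCounts M xs))
    ≡⟨ cong (λ l → cons⁺ (x ∸ at xs 0 + at l 0) l)
            (fromColumns-columnCounts M xs (tail-isPartition ip) len) ⟩
  cons⁺ (x ∸ at xs 0 + at xs 0) xs
    ≡⟨ cong (λ y → cons⁺ y xs) (m∸n+n≡m (head-≥ ip)) ⟩
  cons⁺ x xs
    ≡⟨ cons⁺-positive (All.head (proj₂ ip)) ⟩
  x ∷ xs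
    ∎
  where
  open ≡-Reasoning
  tail-isPartition : ∀ {x xs} → IsPartition (x ∷ xs) → IsPartition xs
  tail-isPartition ([-]     , _ ∷ al) = [] , al
  tail-isPartition (_ ∷ lk , _ ∷ al) = lk , al
  head-≥ : ∀ {x xs} → IsPartition (x ∷ xs) → at xs 0 ≤ x
  head-≥ ([-]       , _) = z≤n
  head-≥ (y≤x ∷ _ , _)   = y≤x

columnCounts-fromColumns : ∀ ms → columnCounts (length ms) (fromColumns ms) ≡ ms
columnCounts-fromColumns []       = refl
columnCounts-fromColumns (m ∷ ms) =
  trans (cons⁺-invariant (columnCounts (suc (length ms))) refl (fromColumns-null m ms))
        (cong₂ _∷_ (m+n∸n≡m m (at (fromColumns ms) 0)) (columnCounts-fromColumns ms))

size-fromColumns : ∀ k ms → k * sum ms + sum (fromColumns ms) ≡ ms · range (suc k) (length ms)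
size-fromColumns k []       = trans (+-identityʳ (k * 0)) (*-zeroʳ k)
size-fromColumns k (m ∷ ms) = begin
  k * (m + sum ms) + sum (cons⁺ (m + at (fromColumns ms) 0) (fromColumns ms))
    ≡⟨ cong (k * (m + sum ms) +_) (cons⁺-invariant sum refl (fromColumns-null m ms)) ⟩
  k * (m + sum ms) + (m + at (fromColumns ms) 0 + sum (fromColumns ms))
    ≡⟨ cong (λ s → k * (m + sum ms) + (m + s + sum (fromColumns ms))) (at-fromColumns ms) ⟩
  k * (m + sum ms) + (m + sum ms + sum (fromColumns ms))
    ≡⟨ regroup k m (sum ms) (sum (fromColumns ms)) ⟩
  m * suc k + (suc k * sum ms + sum (fromColumns ms))
    ≡⟨ cong (m * suc k +_) (size-fromColumns (suc k) ms) ⟩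
  m * suc k + ms · range (suc (suc k)) (length ms)
    ∎
  where
  open ≡-Reasoning
  regroup : ∀ k m s z → k * (m + s) + (m + s + z) ≡ m * suc k + (suc k * s + z)
  regroup = solve-∀

map-range-suc : ∀ {A : Set} (f : ℕ → A) k n → map f (range (suc k) n) ≡ map (f ∘ suc) (range k n)
map-range-suc f k zero    = refl
map-range-suc f k (suc n) = cong (f (suc k) ∷_) (map-range-suc f (suc k) n)

length-range : ∀ k n → length (range k n) ≡ n
length-range k zero    = refl
length-range k (suc n) = cong suc (length-range (suc k) n)

·-map-suc : ∀ ms (l : List ℕ) (g : ℕ → ℕ) → length ms ≡ length l →
  ms · map (suc ∘ g) l ≡ sum ms + ms · map g l
·-map-suc []       []      g _ = refl
·-map-suc (m ∷ ms) (h ∷ l) g e = begin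
  m * suc (g h) + ms · map (suc ∘ g) l   ≡⟨ cong₂ _+_ (*-suc m (g h)) (·-map-suc ms l g (suc-injective e)) ⟩
  m + m * g h + (sum ms + ms · map g l)  ≡⟨ regroup m (sum ms) (m * g h) (ms · map g l) ⟩
  m + sum ms + (m * g h + ms · map g l)  ∎
  where
  open ≡-Reasoning
  regroup : ∀ a b c d → a + c + (b + d) ≡ a + b + (c + d)
  regroup = solve-∀

markedSum-fromColumns : ∀ t′ r′ ms →
  ms · map (markedRows t′ r′) (range 1 (length ms)) ≡ markedSum t′ r′ (fromColumns ms)
markedSum-fromColumns t′ r′       []       = refl
markedSum-fromColumns t′ (suc r′) (m ∷ ms) = begin
  m * 0 + ms · map (markedRows t′ (suc r′)) (range 2 (length ms))
    ≡⟨ cong₂ _+_ (*-zeroʳ m) (cong (ms ·_) (map-range-suc (markedRows t′ (suc r′)) 1 (length ms))) ⟩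
  ms · map (markedRows t′ r′) (range 1 (length ms))
    ≡⟨ markedSum-fromColumns t′ r′ ms ⟩
  markedSum t′ r′ (fromColumns ms)
    ≡⟨ cons⁺-invariant (markedSum t′ (suc r′)) refl (fromColumns-null m ms) ⟨
  markedSum t′ (suc r′) (fromColumns (m ∷ ms))
    ∎
  where open ≡-Reasoning
markedSum-fromColumns t′ zero     (m ∷ ms) = begin
  m * 1 + ms · map (markedRows t′ zero) (range 2 (length ms))
    ≡⟨ cong₂ _+_ (*-identityʳ m) (cong (ms ·_) (map-range-suc (markedRows t′ zero) 1 (length ms))) ⟩
  m + ms · map (suc ∘ markedRows t′ t′) (range 1 (length ms))
    ≡⟨ cong (m +_) (·-map-suc ms _ (markedRows t′ t′) (sym (length-range 1 (length ms)))) ⟩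
  m + (sum ms + ms · map (markedRows t′ t′) (range 1 (length ms)))
    ≡⟨ cong (λ s → m + (s + ms · map (markedRows t′ t′) (range 1 (length ms)))) (at-fromColumns ms) ⟨
  m + (at (fromColumns ms) 0 + ms · map (markedRows t′ t′) (range 1 (length ms)))
    ≡⟨ +-assoc m _ _ ⟨
  m + at (fromColumns ms) 0 + ms · map (markedRows t′ t′) (range 1 (length ms))
    ≡⟨ cong (m + at (fromColumns ms) 0 +_) (markedSum-fromColumns t′ t′ ms) ⟩
  markedSum t′ zero (m + at (fromColumns ms) 0 ∷ fromColumns ms)
    ≡⟨ cons⁺-invariant (markedSum t′ zero) refl (fromColumns-null m ms) ⟨
  markedSum t′ zero (fromColumns (m ∷ ms))
    ∎
  where open ≡-Reasoning

sumTo-cong : ∀ K {f g : ℕ → ℕ} → (∀ m → f m ≡ g m) → sumTo K f ≡ sumTo K g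
sumTo-cong zero    f≗g = f≗g 0
sumTo-cong (suc K) f≗g = cong₂ _+_ (sumTo-cong K f≗g) (f≗g (suc K))

sumTo-zero : ∀ K → sumTo K (λ _ → 0) ≡ 0
sumTo-zero zero    = refl
sumTo-zero (suc K) = cong (_+ 0) (sumTo-zero K)

sumTo-suc : ∀ K (f : ℕ → ℕ) → sumTo (suc K) f ≡ f 0 + sumTo K (f ∘ suc)
sumTo-suc zero    f = refl
sumTo-suc (suc K) f = trans (cong (_+ f (suc (suc K))) (sumTo-suc K f)) (+-assoc (f 0) _ _)

sumTo-markedSum : ∀ t′ r′ l K → length l ≤ K →
  sumTo K (λ m → at l (m * suc t′ + r′)) ≡ markedSum t′ r′ l
sumTo-markedSum t′ r′       []       K _ = sumTo-zero K
sumTo-markedSum t′ (suc r′) (x ∷ xs) K (s≤s len) =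
  trans (sumTo-cong K (λ m → cong (at (x ∷ xs)) (+-suc (m * suc t′) r′)))
        (sumTo-markedSum t′ r′ xs K (m≤n⇒m≤1+n len))
sumTo-markedSum t′ zero     (x ∷ xs) (suc K) (s≤s len) =
  trans (sumTo-suc K _)
        (cong (x +_) (trans (sumTo-cong K (λ m → cong (at xs) (rotate m)))
                            (sumTo-markedSum t′ t′ xs K len)))
  where
  rotate : ∀ m → t′ + m * suc t′ + 0 ≡ m * suc t′ + t′
  rotate m = trans (+-identityʳ _) (+-comm t′ _)

stat≡markedSum : ∀ t′ r′ (p : Partition) → stat (suc t′) (suc r′) p ≡ markedSum t′ r′ (proj₁ p)
stat≡markedSum t′ r′ (l , _) =
  trans (sumTo-cong (length l) (λ m → cong (at l ∘ pred) (+-suc (m * suc t′) r′)))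
        (sumTo-markedSum t′ r′ l (length l) ≤-refl)

partition-≡ : {p q : Partition} → proj₁ p ≡ proj₁ q → p ≡ q
partition-≡ = proj₁-injective (×-irrelevant (Linked.irrelevant ≤-irrelevant) (All.irrelevant ≤-irrelevant))

length≤sum : ∀ {l} → All (0 <_) l → length l ≤ sum l
length≤sum []         = z≤n
length≤sum (x>0 ∷ xs) = +-mono-≤ x>0 (length≤sum xs)

Partitions : ℕ → ℕ → Graded
Partitions t r = record { Carrier = Partition ; zdeg = λ p → part p 1 ; sdeg = size ; qdeg = stat t r }

PartitionsOfLength≤ : ℕ → ℕ → ℕ → Graded
PartitionsOfLength≤ t r M = record
  { Carrier = Σ[ p ∈ Partition ] length (proj₁ p) ≤ M
  ; zdeg    = λ (p , _) → part p 1
  ; sdeg    = λ (p , _) → size p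
  ; qdeg    = λ (p , _) → stat t r p
  }

fibre-unbounded : ∀ t r M {a b c} → b ≤ M →
  Fibre (PartitionsOfLength≤ t r M) a b c ↔ Fibre (Partitions t r) a b c
fibre-unbounded t r M {a} {b} {c} b≤M =
  mk↔ₛ′ to from (λ _ → refl) (λ _ → fibre-≡ (proj₁-injective ≤-irrelevant refl))
  where
  to : Fibre (PartitionsOfLength≤ t r M) a b c → Fibre (Partitions t r) a b c
  to ((p , _) , e) = p , e
  from : Fibre (Partitions t r) a b c → Fibre (PartitionsOfLength≤ t r M) a b c
  from (p , e₁ , e₂ , e₃) =
    (p , ≤-trans (length≤sum (proj₂ (proj₂ p))) (subst (_≤ M) (sym e₂) b≤M)) , e₁ , e₂ , e₃

length-columnWeights : ∀ t′ r′ M → length (columnWeights t′ r′ M) ≡ M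
length-columnWeights t′ r′ M = trans (length-map _ (range 1 M)) (length-range 1 M)

columns≅ : ∀ t′ r′ M → Multiplicities (columnWeights t′ r′ M) ≅ PartitionsOfLength≤ (suc t′) (suc r′) M
columns≅ t′ r′ M = record
  { carrier↔ = mk↔ₛ′ to from to∘from from∘to
  ; zdeg-to  = λ (ms , _) → at-fromColumns ms
  ; sdeg-to  = sdeg-to
  ; qdeg-to  = qdeg-to
  }
  where
  W : List Weight
  W = columnWeights t′ r′ M
  A B : Graded
  A = Multiplicities W
  B = PartitionsOfLength≤ (suc t′) (suc r′) M

  length≡M : ∀ ms → length ms ≡ length W → length ms ≡ M
  length≡M _ len = trans len (length-columnWeights t′ r′ M)

  to : Carrier A → Carrier B
  to (ms , len) =
    (fromColumns ms , fromColumns-isPartition ms) , ≤-trans (length-fromColumns ms) (≤-reflexive (length≡M ms len))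

  from : Carrier B → Carrier A
  from ((l , _) , _) = columnCounts M l , trans (length-columnCounts M l) (sym (length-columnWeights t′ r′ M))

  to∘from : ∀ y → to (from y) ≡ y
  to∘from ((l , ip) , len≤M) =
    proj₁-injective ≤-irrelevant (partition-≡ (fromColumns-columnCounts M l ip len≤M))

  from∘to : ∀ x → from (to x) ≡ x
  from∘to (ms , len) =
    multiplicities-≡ {W}
      (subst (λ n → columnCounts n (fromColumns ms) ≡ ms) (length≡M ms len) (columnCounts-fromColumns ms))

  sdeg-to : ∀ x → sdeg B (to x) ≡ sdeg A x
  sdeg-to (ms , len) = begin
    sum (fromColumns ms)                         ≡⟨ size-fromColumns 0 ms ⟩
    ms · range 1 (length ms)                     ≡⟨ cong (λ n → ms · range 1 n) (length≡M ms len) ⟩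
    ms · range 1 M                               ≡⟨ cong (ms ·_) (map-id (range 1 M)) ⟨
    ms · map (λ h → h) (range 1 M)               ≡⟨ cong (ms ·_) (map-∘ (range 1 M)) ⟩
    ms · map proj₁ W                             ∎
    where open ≡-Reasoning

  qdeg-to : ∀ x → qdeg B (to x) ≡ qdeg A x
  qdeg-to (ms , len) = begin
    stat (suc t′) (suc r′) (proj₁ (to (ms , len)))
      ≡⟨ stat≡markedSum t′ r′ (proj₁ (to (ms , len))) ⟩
    markedSum t′ r′ (fromColumns ms)
      ≡⟨ markedSum-fromColumns t′ r′ ms ⟨
    ms · map (markedRows t′ r′) (range 1 (length ms))
      ≡⟨ cong (λ n → ms · map (markedRows t′ r′) (range 1 n)) (length≡M ms len) ⟩
    ms · map (markedRows t′ r′) (range 1 M)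
      ≡⟨ cong (ms ·_) (map-∘ (range 1 M)) ⟩
    ms · map proj₂ W
      ∎
    where open ≡-Reasoning

theorem8 : (t r : ℕ) → 1 ≤ t → 1 ≤ r →
    (a b c : ℕ) → ∃ λ N₀ → (N : ℕ) → N ≥ N₀ →
      Fin (rhsPartial t r N a b c)
        ↔ Σ Partition (λ λ′ → part λ′ 1 ≡ a × size λ′ ≡ b × stat t r λ′ ≡ c)
theorem8 (suc t′) (suc r′) _ _ a b c = b , λ N b≤N →
  let M = r′ + N * suc t′
      b≤M = ≤-trans b≤N (≤-trans (m≤m*n N (suc t′)) (m≤n+m (N * suc t′) r′))
  in begin
  Fin (rhsPartial (suc t′) (suc r′) N a b c)            ↔⟨ rhsPartial-counts t′ r′ N a b c ⟩
  Fibre (Multiplicities (columnWeights t′ r′ M)) a b c  ↔⟨ fibre-≅ (columns≅ t′ r′ M) a b c ⟩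
  Fibre (PartitionsOfLength≤ (suc t′) (suc r′) M) a b c    ↔⟨ fibre-unbounded (suc t′) (suc r′) M b≤M ⟩
  Fibre (Partitions (suc t′) (suc r′)) a b c            ∎
  where open ↔-Reasoning
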